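{- The only maximal simplifications (from inside or from outside) are the following four sets of transformations: $r_1$: $\neg \neg (\neg \neg A \wedge \neg \neg B) \Rightarrow \neg \neg (A \wedge B)$; $\neg \neg (\neg \neg A \vee \neg \neg B) \Rightarrow \neg \neg (A \vee B)$; $\neg \neg (\neg \neg A \to \neg \neg B) \Rightarrow \neg \neg (A \to B)$; $\neg\neg \exists x \neg \neg A \Rightarrow \neg \neg \exists x A$. $r_2$: $\neg \neg ( \neg A \wedge \neg B) \Rightarrow \neg ( A \vee B)$; $\neg \neg ( \neg A \vee \neg B) \Rightarrow \neg (A \wedge B)$; $\neg \neg (\neg A \to \neg B) \Rightarrow \neg (\neg A \wedge B)$; $\neg \neg \forall x \neg A \Rightarrow \neg \exists x A$. $r_3$: $\neg \neg (\neg \neg A \wedge \neg \neg B) \Rightarrow \neg \neg A \wedge \neg \neg B$; $\neg \neg (\neg \neg A \vee \neg \neg B) \Rightarrow \neg \neg \neg A \to \neg \neg B$; $\neg \neg (\neg \neg A \to \neg \neg B) \Rightarrow \neg \neg A \to \neg \neg B$; $\neg\neg \forall x \neg \neg A \Rightarrow \forall x \neg \neg A$. $r_4$: $\neg (\neg \neg A \wedge \neg \neg B) \Rightarrow \neg \neg A \to \neg B$; $\neg (\neg \neg A \vee \neg \neg B) \Rightarrow \neg A \wedge \neg B$; $\neg (\neg \neg A \to \neg \neg B) \Rightarrow \neg \neg A \wedge \neg B$; $\neg \exists x \neg \neg A \Rightarrow \forall x \neg A$.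
   Context: Work in first-order logic with primitives $\bot,\top,\wedge,\vee,\to,\forall,\exists$; $\neg C$ abbreviates $C\to\bot$; ${\sf IL}$ is intuitionistic logic. In transformations, $A,B$ are schematic formula variables and $x$ a variable; $\square, \square^{r}$ range over $\{\wedge, \vee, \to\}$, $Q, Q^{r}$ over $\{\forall, \exists\}$; $N$ denotes either $\neg$ or $\neg\neg$ (the same choice for all transformations of a set), and $N_1,N_2$ denote strings of negations, possibly empty, not necessarily the same in different transformations. A simplification from inside is a set of transformations, at most one for each symbol in $\{\wedge,\vee,\to,\forall,\exists\}$, each of the form $\neg \neg (N A \,\square\, N B) \Rightarrow N (N_1 A \;\square^{r}\, N_2 B)$ or $\neg\neg Q x N A \Rightarrow N (Q^{r} x N_1 A)$. A simplification from outside is defined in the same way but with transformations of the form $N(\neg \neg A \,\square\, \neg \neg B) \Rightarrow N_1 N A \, \square^{r} N_2 N B$ or $NQ x \neg \neg A \Rightarrow Q^{r} x N_1 N A$. In both cases it is required that for each transformation (i) both sides are ${\sf IL}$-equivalent for all formulas $A,B$, and (ii) the number of negation symbols on the right side is strictly less than on the left side. A simplification is maximal if (i) it is not properly included in any other simplification (of the same kind), i.e. adding transformations for further connectives/quantifiers prevents the set from being a simplification, and (ii) it is not possible to replace $\square^r$, $Q^r$, $N_1$, $N_2$ in any transformation so as to reduce the number of negations on its right side while remaining a simplification. -}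

module Defs where

open import Data.Nat using (ℕ; zero; suc; _+_; _*_; _<_)
open import Data.Fin using (Fin; zero; suc)
open import Data.Vec using (Vec)
import Data.Vec as Vec
open import Data.List using (List; []; _∷_)
import Data.List as List
open import Data.List.Membership.Propositional using (_∈_)
open import Data.Maybe using (Maybe; just; nothing)
open import Data.Product using (_×_; _,_)
open import Relation.Binary.PropositionalEquality using (_≡_)
open import Relation.Nullary using (¬_; yes; no)

-- First-order formulas (de Bruijn variables; scope n = number of
-- available free variables).  Terms are variables; countably many
-- predicate symbols of every arity.

data Formula (n : ℕ) : Set where
  atom        : (p k : ℕ) → Vec (Fin n) k → Formula n
  ⊥' ⊤'       : Formula n
  _∧'_ _∨'_ _⇒_ : Formula n → Formula n → Formula n
  ∀' ∃'       : Formula (suc n) → Formula n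

infixr 6 _∧'_
infixr 5 _∨'_
infixr 4 _⇒_

¬' : ∀ {n} → Formula n → Formula n
¬' C = C ⇒ ⊥'

negs : ∀ {n} → ℕ → Formula n → Formula n
negs zero    C = C
negs (suc k) C = ¬' (negs k C)

lift : ∀ {n m} → (Fin n → Fin m) → Fin (suc n) → Fin (suc m)
lift ρ zero    = zero
lift ρ (suc i) = suc (ρ i)

rename : ∀ {n m} → (Fin n → Fin m) → Formula n → Formula m
rename ρ (atom p k ts) = atom p k (Vec.map ρ ts)
rename ρ ⊥' = ⊥'
rename ρ ⊤' = ⊤'
rename ρ (A ∧' B) = rename ρ A ∧' rename ρ B
rename ρ (A ∨' B) = rename ρ A ∨' rename ρ B
rename ρ (A ⇒ B) = rename ρ A ⇒ rename ρ B
rename ρ (∀' A) = ∀' (rename (lift ρ) A)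
rename ρ (∃' A) = ∃' (rename (lift ρ) A)

shift : ∀ {n} → Formula n → Formula (suc n)
shift = rename suc

inst : ∀ {n} → Fin n → Fin (suc n) → Fin n
inst t zero    = t
inst t (suc i) = i

_[_] : ∀ {n} → Formula (suc n) → Fin n → Formula n
A [ t ] = rename (inst t) A

infix 2 _⊢_
data _⊢_ {n : ℕ} (Γ : List (Formula n)) : Formula n → Set where
  hyp  : ∀ {A} → A ∈ Γ → Γ ⊢ A
  ⊤I   : Γ ⊢ ⊤'
  ⊥E   : ∀ {A} → Γ ⊢ ⊥' → Γ ⊢ A
  ∧I   : ∀ {A B} → Γ ⊢ A → Γ ⊢ B → Γ ⊢ A ∧' B
  ∧E₁  : ∀ {A B} → Γ ⊢ A ∧' B → Γ ⊢ A
  ∧E₂  : ∀ {A B} → Γ ⊢ A ∧' B → Γ ⊢ B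
  ∨I₁  : ∀ {A B} → Γ ⊢ A → Γ ⊢ A ∨' B
  ∨I₂  : ∀ {A B} → Γ ⊢ B → Γ ⊢ A ∨' B
  ∨E   : ∀ {A B C} → Γ ⊢ A ∨' B → (A ∷ Γ) ⊢ C → (B ∷ Γ) ⊢ C → Γ ⊢ C
  ⇒I   : ∀ {A B} → (A ∷ Γ) ⊢ B → Γ ⊢ A ⇒ B
  ⇒E   : ∀ {A B} → Γ ⊢ A ⇒ B → Γ ⊢ A → Γ ⊢ B
  ∀I   : ∀ {A} → List.map shift Γ ⊢ A → Γ ⊢ ∀' A
  ∀E   : ∀ {A} → Γ ⊢ ∀' A → (t : Fin n) → Γ ⊢ A [ t ]
  ∃I   : ∀ {A} (t : Fin n) → Γ ⊢ A [ t ] → Γ ⊢ ∃' A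
  ∃E   : ∀ {A C} → Γ ⊢ ∃' A → (A ∷ List.map shift Γ) ⊢ shift C → Γ ⊢ C

-- IL-provability of a formula with free variables among 0..n-1.  As in
-- ordinary first-order logic the supply of variables is unlimited, so we
-- allow one additional (fresh) variable to be available as a term.
ILProves : ∀ {n} → Formula n → Set
ILProves A = [] ⊢ shift A

ILEquiv : ∀ {n} → Formula n → Formula n → Set
ILEquiv A B = ILProves (A ⇒ B) × ILProves (B ⇒ A)

data Bin : Set where
  and or imp : Bin

data Quant : Set where
  all ex : Quant

bin : ∀ {n} → Bin → Formula n → Formula n → Formula n
bin and A B = A ∧' B
bin or  A B = A ∨' B
bin imp A B = A ⇒ B

quant : ∀ {n} → Quant → Formula (suc n) → Formula n
quant all A = ∀' A
quant ex  A = ∃' A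

_≟B_ : (a b : Bin) → Relation.Nullary.Dec (a ≡ b)
and ≟B and = yes _≡_.refl
and ≟B or  = no λ ()
and ≟B imp = no λ ()
or  ≟B and = no λ ()
or  ≟B or  = yes _≡_.refl
or  ≟B imp = no λ ()
imp ≟B and = no λ ()
imp ≟B or  = no λ ()
imp ≟B imp = yes _≡_.refl

_≟Q_ : (a b : Quant) → Relation.Nullary.Dec (a ≡ b)
all ≟Q all = yes _≡_.refl
all ≟Q ex  = no λ ()
ex  ≟Q all = no λ ()
ex  ≟Q ex  = yes _≡_.refl

data Kind : Set where
  inside outside : Kind

data NegN : Set where
  one two : NegN

∣_∣ : NegN → ℕ
∣ one ∣ = 1
∣ two ∣ = 2

N⟦_⟧ : ∀ {n} → NegN → Formula n → Formula n
N⟦ N ⟧ = negs ∣ N ∣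

-- Right-hand-side data of a transformation: for a connective □ the triple
-- (□ʳ , |N₁| , |N₂|), for a quantifier Q the pair (Qʳ , |N₁|).
BinRHS : Set
BinRHS = Bin × ℕ × ℕ

QuantRHS : Set
QuantRHS = Quant × ℕ

lhsBin : Kind → NegN → Bin → ∀ {n} → Formula n → Formula n → Formula n
lhsBin inside  N □ A B = negs 2 (bin □ (N⟦ N ⟧ A) (N⟦ N ⟧ B))
lhsBin outside N □ A B = N⟦ N ⟧ (bin □ (negs 2 A) (negs 2 B))

rhsBin : Kind → NegN → BinRHS → ∀ {n} → Formula n → Formula n → Formula n
rhsBin inside  N (□ʳ , n₁ , n₂) A B = N⟦ N ⟧ (bin □ʳ (negs n₁ A) (negs n₂ B))
rhsBin outside N (□ʳ , n₁ , n₂) A B = bin □ʳ (negs n₁ (N⟦ N ⟧ A)) (negs n₂ (N⟦ N ⟧ B))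

lhsQuant : Kind → NegN → Quant → ∀ {n} → Formula (suc n) → Formula n
lhsQuant inside  N Q A = negs 2 (quant Q (N⟦ N ⟧ A))
lhsQuant outside N Q A = N⟦ N ⟧ (quant Q (negs 2 A))

rhsQuant : Kind → NegN → QuantRHS → ∀ {n} → Formula (suc n) → Formula n
rhsQuant inside  N (Qʳ , n₁) A = N⟦ N ⟧ (quant Qʳ (negs n₁ A))
rhsQuant outside N (Qʳ , n₁) A = quant Qʳ (negs n₁ (N⟦ N ⟧ A))

lhsNegsBin : Kind → NegN → ℕ
lhsNegsBin inside  N = 2 + 2 * ∣ N ∣
lhsNegsBin outside N = ∣ N ∣ + 4

rhsNegsBin : Kind → NegN → BinRHS → ℕ
rhsNegsBin inside  N (_ , n₁ , n₂) = ∣ N ∣ + n₁ + n₂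
rhsNegsBin outside N (_ , n₁ , n₂) = n₁ + n₂ + 2 * ∣ N ∣

lhsNegsQuant : Kind → NegN → ℕ
lhsNegsQuant inside  N = 2 + ∣ N ∣
lhsNegsQuant outside N = ∣ N ∣ + 2

rhsNegsQuant : Kind → NegN → QuantRHS → ℕ
rhsNegsQuant inside  N (_ , n₁) = ∣ N ∣ + n₁
rhsNegsQuant outside N (_ , n₁) = n₁ + ∣ N ∣

ValidBin : Kind → NegN → Bin → BinRHS → Set
ValidBin k N □ d =
  (∀ n (A B : Formula n) → ILEquiv (lhsBin k N □ A B) (rhsBin k N d A B))
  × rhsNegsBin k N d < lhsNegsBin k N

ValidQuant : Kind → NegN → Quant → QuantRHS → Set
ValidQuant k N Q d =
  (∀ n (A : Formula (suc n)) → ILEquiv (lhsQuant k N Q A) (rhsQuant k N d A))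
  × rhsNegsQuant k N d < lhsNegsQuant k N

record TransSet : Set where
  constructor mkTS
  field
    kind  : Kind
    neg   : NegN
    binT  : Bin → Maybe BinRHS
    quanT : Quant → Maybe QuantRHS
open TransSet public

IsSimplification : TransSet → Set
IsSimplification S =
  (∀ □ d → binT S □ ≡ just d → ValidBin (kind S) (neg S) □ d)
  × (∀ Q d → quanT S Q ≡ just d → ValidQuant (kind S) (neg S) Q d)

_⊆T_ : TransSet → TransSet → Set
S ⊆T T = kind S ≡ kind T
  × (∀ □ d → binT S □ ≡ just d → (neg S ≡ neg T) × (binT T □ ≡ just d))
  × (∀ Q d → quanT S Q ≡ just d → (neg S ≡ neg T) × (quanT T Q ≡ just d))

updB : (Bin → Maybe BinRHS) → Bin → BinRHS → Bin → Maybe BinRHS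
updB f □ d □' with □' ≟B □
... | yes _ = just d
... | no  _ = f □'

updQ : (Quant → Maybe QuantRHS) → Quant → QuantRHS → Quant → Maybe QuantRHS
updQ f Q d Q' with Q' ≟Q Q
... | yes _ = just d
... | no  _ = f Q'

IsMaximal : TransSet → Set
IsMaximal S =
  IsSimplification S
  × (∀ T → IsSimplification T → S ⊆T T → T ⊆T S)
  × (∀ □ d d' → binT S □ ≡ just d → rhsNegsBin (kind S) (neg S) d' < rhsNegsBin (kind S) (neg S) d
       → ¬ IsSimplification (mkTS (kind S) (neg S) (updB (binT S) □ d') (quanT S)))
  × (∀ Q d d' → quanT S Q ≡ just d → rhsNegsQuant (kind S) (neg S) d' < rhsNegsQuant (kind S) (neg S) d
       → ¬ IsSimplification (mkTS (kind S) (neg S) (binT S) (updQ (quanT S) Q d')))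

_≈T_ : TransSet → TransSet → Set
S ≈T T = kind S ≡ kind T × neg S ≡ neg T
  × (∀ □ → binT S □ ≡ binT T □) × (∀ Q → quanT S Q ≡ quanT T Q)

r₁ : TransSet
r₁ = mkTS inside two
  (λ { and → just (and , 0 , 0) ; or → just (or , 0 , 0) ; imp → just (imp , 0 , 0) })
  (λ { all → nothing ; ex → just (ex , 0) })

r₂ : TransSet
r₂ = mkTS inside one
  (λ { and → just (or , 0 , 0) ; or → just (and , 0 , 0) ; imp → just (and , 1 , 0) })
  (λ { all → just (ex , 0) ; ex → nothing })

r₃ : TransSet
r₃ = mkTS outside two
  (λ { and → just (and , 0 , 0) ; or → just (imp , 1 , 0) ; imp → just (imp , 0 , 0) })
  (λ { all → just (all , 0) ; ex → nothing })

r₄ : TransSet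
r₄ = mkTS outside one
  (λ { and → just (imp , 1 , 0) ; or → just (and , 0 , 0) ; imp → just (and , 1 , 0) })
  (λ { all → nothing ; ex → just (all , 0) })

module Submission where

-- A set of transformations fixes its kind and N, so for each connective or quantifier the
-- competing transformations differ only in their right sides.  Call an entry best if it is
-- the unique valid right side with the fewest negations, or absent when no right side is
-- valid, and call a set optimal if all its entries are best.  The first part of the file
-- shows, purely combinatorially, that every maximal simplification has the best entry for
-- each symbol and that a non-empty optimal set is maximal; so, for an optimal R, the
-- maximal simplifications of R's kind and N are exactly the sets equal to R.
-- The rest shows that r₁ … r₄ are optimal.  Every competitor within the negation budget is refuted
-- semantically, through soundness for Kripke models: most already fail in a two-valued
-- model, found by evaluating under sixteen valuations, and the remaining six fail in a
-- three-world fork or in a model whose atoms grow along ℕ.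

open import Defs
open import Data.Nat using (ℕ; zero; suc; _+_; _*_; _≤_; _<_; _<ᵇ_; _≤?_; s≤s; s≤s⁻¹)
open import Data.Nat.Properties
  using (≤-refl; ≤-trans; <-≤-trans; <-irrefl; <⇒≤; ≰⇒>; m≤m+n; m≤n+m; n≤1+n; <ᵇ⇒<; +-assoc;
         +-cancelˡ-≤; +-cancelʳ-≤; +-cancelˡ-<; +-cancelʳ-<)
open import Data.Fin using (Fin; zero; suc)
open import Data.Vec using (Vec; []; _∷_)
import Data.Vec as Vec
import Data.Vec.Properties as Vec
open import Data.List using (List; []; _∷_)
import Data.List as List
open import Data.List.Relation.Unary.All using (All; []; _∷_)
import Data.List.Relation.Unary.All as All
open import Data.List.Relation.Unary.Any using (here; there)
open import Data.Bool using (Bool; true; false; T; not; _∧_; if_then_else_)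
open import Data.Bool.Properties using (T-∧)
open import Data.Maybe using (Maybe; just; nothing)
open import Data.Product using (Σ; _×_; _,_; proj₁; proj₂)
open import Data.Sum using (_⊎_; inj₁; inj₂)
open import Data.Empty using (⊥; ⊥-elim)
open import Data.Unit using (⊤; tt)
open import Relation.Nullary using (¬_; Dec; yes; no)
open import Relation.Nullary.Decidable using (map′; _×-dec_; _⊎-dec_; _→-dec_; T?; isYes; fromWitness)
open import Relation.Binary.PropositionalEquality
  using (_≡_; _≢_; refl; sym; trans; cong; cong₂; subst; subst₂)
open import Function.Bundles using (_⇔_; mk⇔; Equivalence)
import Function.Properties.Equivalence as ⇔

open Equivalence using (to; from)

Best : {RHS : Set} → (RHS → Set) → (RHS → ℕ) → Maybe RHS → Set
Best Valid cost nothing   = ∀ d → ¬ Valid d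
Best Valid cost (just d*) = Valid d* × (∀ d → Valid d → cost d ≤ cost d* → d ≡ d*)

BestBin : Kind → NegN → Bin → Maybe BinRHS → Set
BestBin k N □ = Best (ValidBin k N □) (rhsNegsBin k N)

BestQuant : Kind → NegN → Quant → Maybe QuantRHS → Set
BestQuant k N Q = Best (ValidQuant k N Q) (rhsNegsQuant k N)

Optimal : TransSet → Set
Optimal S = (∀ □ → BestBin (kind S) (neg S) □ (binT S □)) × (∀ Q → BestQuant (kind S) (neg S) Q (quanT S Q))

-- Non-emptiness pins down N when comparing with an enlargement (which need only agree on N
-- where it has entries).
NonEmpty : TransSet → Set
NonEmpty S = Σ Bin λ □ → Σ BinRHS λ d → binT S □ ≡ just d

nothing≢just : ∀ {A : Set} {x : A} → nothing ≢ just x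
nothing≢just ()

Best-valid : ∀ {RHS} {Valid : RHS → Set} {cost m d} → Best Valid cost m → m ≡ just d → Valid d
Best-valid (valid , _) refl = valid

Best-characterised : ∀ {RHS} {Valid : RHS → Set} {cost} {m t : Maybe RHS} → Best Valid cost m
  → (∀ {d} → t ≡ just d → Valid d)
  → (∀ {d*} → Valid d* → t ≡ nothing → ⊥)
  → (∀ {d d*} → Valid d* → t ≡ just d → cost d* < cost d → ⊥)
  → t ≡ m
Best-characterised {m = nothing} {nothing} _ _ _ _ = refl
Best-characterised {m = nothing} {just d}  none valid _ _ = ⊥-elim (none d (valid refl))
Best-characterised {m = just d*} {nothing} (valid* , _) _ unfilled _ = ⊥-elim (unfilled valid* refl)
Best-characterised {cost = cost} {just d*} {just d} (valid* , unique) valid _ improvable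
  with cost d ≤? cost d*
... | yes d≤d* = cong just (unique d (valid refl) d≤d*)
... | no  d≰d* = ⊥-elim (improvable valid* refl (≰⇒> d≰d*))

Best-contained : ∀ {RHS} {Valid : RHS → Set} {cost} {m t : Maybe RHS} {d} → Best Valid cost m
  → Valid d → (∀ {d*} → m ≡ just d* → t ≡ just d*) → t ≡ just d → m ≡ just d
Best-contained {m = nothing} none valid _ _ = ⊥-elim (none _ valid)
Best-contained {m = just d*} _ _ contains t≡d = trans (sym (contains refl)) t≡d

Best-unimprovable : ∀ {RHS} {Valid : RHS → Set} {cost} {m : Maybe RHS} {d d′} → Best Valid cost m
  → m ≡ just d → Valid d′ → cost d′ < cost d → ⊥
Best-unimprovable (_ , unique) refl valid′ lt with unique _ valid′ (<⇒≤ lt)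
... | refl = <-irrefl refl lt

updB-at : ∀ f □ d → updB f □ d □ ≡ just d
updB-at f □ d with □ ≟B □
... | yes _ = refl
... | no □≢□ = ⊥-elim (□≢□ refl)

updQ-at : ∀ f Q d → updQ f Q d Q ≡ just d
updQ-at f Q d with Q ≟Q Q
... | yes _ = refl
... | no Q≢Q = ⊥-elim (Q≢Q refl)

updB-simplification : ∀ S □ d → IsSimplification S → ValidBin (kind S) (neg S) □ d
                    → IsSimplification (mkTS (kind S) (neg S) (updB (binT S) □ d) (quanT S))
updB-simplification S □ d (validB , validQ) valid = valid′ , validQ
  where valid′ : ∀ □′ d′ → updB (binT S) □ d □′ ≡ just d′ → ValidBin (kind S) (neg S) □′ d′
        valid′ □′ d′ with □′ ≟B □
        ... | yes refl = λ { refl → valid }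
        ... | no _     = validB □′ d′

updQ-simplification : ∀ S Q d → IsSimplification S → ValidQuant (kind S) (neg S) Q d
                    → IsSimplification (mkTS (kind S) (neg S) (binT S) (updQ (quanT S) Q d))
updQ-simplification S Q d (validB , validQ) valid = validB , valid′
  where valid′ : ∀ Q′ d′ → updQ (quanT S) Q d Q′ ≡ just d′ → ValidQuant (kind S) (neg S) Q′ d′
        valid′ Q′ d′ with Q′ ≟Q Q
        ... | yes refl = λ { refl → valid }
        ... | no _     = validQ Q′ d′

updB-enlarges : ∀ S □ d → binT S □ ≡ nothing → S ⊆T mkTS (kind S) (neg S) (updB (binT S) □ d) (quanT S)
updB-enlarges S □ d empty = refl , (λ □′ d′ e → refl , kept □′ d′ e) , (λ _ _ e → refl , e)
  where kept : ∀ □′ d′ → binT S □′ ≡ just d′ → updB (binT S) □ d □′ ≡ just d′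
        kept □′ d′ with □′ ≟B □
        ... | yes refl = λ e → ⊥-elim (nothing≢just (trans (sym empty) e))
        ... | no _     = λ e → e

updQ-enlarges : ∀ S Q d → quanT S Q ≡ nothing → S ⊆T mkTS (kind S) (neg S) (binT S) (updQ (quanT S) Q d)
updQ-enlarges S Q d empty = refl , (λ _ _ e → refl , e) , (λ Q′ d′ e → refl , kept Q′ d′ e)
  where kept : ∀ Q′ d′ → quanT S Q′ ≡ just d′ → updQ (quanT S) Q d Q′ ≡ just d′
        kept Q′ d′ with Q′ ≟Q Q
        ... | yes refl = λ e → ⊥-elim (nothing≢just (trans (sym empty) e))
        ... | no _     = λ e → e

maximal⇒bestB : ∀ {S} → IsMaximal S → ∀ □ {m} → BestBin (kind S) (neg S) □ m → binT S □ ≡ m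
maximal⇒bestB {S} (simp , enlargements , improveB , _) □ best =
  Best-characterised best (proj₁ simp □ _) unfilled
    (λ {d} {d*} valid* e lt → improveB □ d d* e lt (updB-simplification S □ d* simp valid*))
  where
    -- Filling an empty slot with a valid entry gives a simplification S′ enlarging S, so by
    -- maximality S′ ⊆ S and the slot was not empty.
    unfilled : ∀ {d*} → ValidBin (kind S) (neg S) □ d* → binT S □ ≡ nothing → ⊥
    unfilled {d*} valid* empty =
      nothing≢just (trans (sym empty) (proj₂ (proj₁ (proj₂ S′⊆S) □ d* (updB-at (binT S) □ d*))))
      where S′ : TransSet
            S′ = mkTS (kind S) (neg S) (updB (binT S) □ d*) (quanT S)
            S′⊆S : S′ ⊆T S
            S′⊆S = enlargements S′ (updB-simplification S □ d* simp valid*) (updB-enlarges S □ d* empty)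

maximal⇒bestQ : ∀ {S} → IsMaximal S → ∀ Q {m} → BestQuant (kind S) (neg S) Q m → quanT S Q ≡ m
maximal⇒bestQ {S} (simp , enlargements , _ , improveQ) Q best =
  Best-characterised best (proj₂ simp Q _) unfilled
    (λ {d} {d*} valid* e lt → improveQ Q d d* e lt (updQ-simplification S Q d* simp valid*))
  where
    unfilled : ∀ {d*} → ValidQuant (kind S) (neg S) Q d* → quanT S Q ≡ nothing → ⊥
    unfilled {d*} valid* empty =
      nothing≢just (trans (sym empty) (proj₂ (proj₂ (proj₂ S′⊆S) Q d* (updQ-at (quanT S) Q d*))))
      where S′ : TransSet
            S′ = mkTS (kind S) (neg S) (binT S) (updQ (quanT S) Q d*)
            S′⊆S : S′ ⊆T S
            S′⊆S = enlargements S′ (updQ-simplification S Q d* simp valid*) (updQ-enlarges S Q d* empty)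

optimal⇒maximal : ∀ {S} → Optimal S → NonEmpty S → IsMaximal S
optimal⇒maximal {mkTS k N b q} (bestB , bestQ) (□₀ , d₀ , e₀) = simp , enlargement , improveB , improveQ
  where
    simp : IsSimplification (mkTS k N b q)
    simp = (λ □ _ → Best-valid (bestB □)) , (λ Q _ → Best-valid (bestQ Q))

    enlargement : ∀ T → IsSimplification T → mkTS k N b q ⊆T T → T ⊆T mkTS k N b q
    -- N is shared with T because T contains the entry of S at □₀; every entry of T is
    -- valid, hence already present in S.
    enlargement (mkTS k _ _ _) (validB , validQ) (refl , containsB , containsQ)
      with proj₁ (containsB □₀ d₀ e₀)
    ... | refl = refl , (λ □ d e → refl , Best-contained (bestB □) (validB □ d e) (λ e* → proj₂ (containsB □ _ e*)) e)
                      , (λ Q d e → refl , Best-contained (bestQ Q) (validQ Q d e) (λ e* → proj₂ (containsQ Q _ e*)) e)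

    improveB : ∀ □ d d′ → b □ ≡ just d → rhsNegsBin k N d′ < rhsNegsBin k N d
             → ¬ IsSimplification (mkTS k N (updB b □ d′) q)
    improveB □ d d′ e lt (validB′ , _) = Best-unimprovable (bestB □) e (validB′ □ d′ (updB-at b □ d′)) lt

    improveQ : ∀ Q d d′ → q Q ≡ just d → rhsNegsQuant k N d′ < rhsNegsQuant k N d
             → ¬ IsSimplification (mkTS k N b (updQ q Q d′))
    improveQ Q d d′ e lt (_ , validQ′) = Best-unimprovable (bestQ Q) e (validQ′ Q d′ (updQ-at q Q d′)) lt

characterisation : ∀ {R} → Optimal R → NonEmpty R → ∀ b q
                 → IsMaximal (mkTS (kind R) (neg R) b q) ⇔ mkTS (kind R) (neg R) b q ≈T R
characterisation {R} (bestB , bestQ) (□₀ , d₀ , e₀) b q =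
  mk⇔ agree (λ eq → optimal⇒maximal (transport eq) (nonEmpty eq))
  where
    agree : IsMaximal (mkTS (kind R) (neg R) b q) → mkTS (kind R) (neg R) b q ≈T R
    agree max = refl , refl , (λ □ → maximal⇒bestB max □ (bestB □)) , (λ Q → maximal⇒bestQ max Q (bestQ Q))

    transport : mkTS (kind R) (neg R) b q ≈T R → Optimal (mkTS (kind R) (neg R) b q)
    transport (_ , _ , eqB , eqQ) = (λ □ → subst (BestBin (kind R) (neg R) □) (sym (eqB □)) (bestB □))
                                  , (λ Q → subst (BestQuant (kind R) (neg R) Q) (sym (eqQ Q)) (bestQ Q))

    nonEmpty : mkTS (kind R) (neg R) b q ≈T R → NonEmpty (mkTS (kind R) (neg R) b q)
    nonEmpty (_ , _ , eqB , _) = □₀ , d₀ , trans (eqB □₀) e₀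

record KripkeModel : Set₁ where
  field
    World     : Set
    _≼_       : World → World → Set
    ≼-refl    : ∀ {w} → w ≼ w
    ≼-trans   : ∀ {u v w} → u ≼ v → v ≼ w → u ≼ w
    Dom       : Set
    element   : Dom
    Atom      : World → ℕ → (k : ℕ) → Vec Dom k → Set
    Atom-mono : ∀ {w v} → w ≼ v → ∀ p k ts → Atom w p k ts → Atom v p k ts

extend : ∀ {D : Set} {n} → D → (Fin n → D) → Fin (suc n) → D
extend d ρ zero    = d
extend d ρ (suc i) = ρ i

module Forcing (M : KripkeModel) where
  open KripkeModel M

  Forces : ∀ {n} → World → (Fin n → Dom) → Formula n → Set
  Forces w ρ (atom p k ts) = Atom w p k (Vec.map ρ ts)
  Forces w ρ ⊥'       = ⊥
  Forces w ρ ⊤'       = ⊤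
  Forces w ρ (A ∧' B) = Forces w ρ A × Forces w ρ B
  Forces w ρ (A ∨' B) = Forces w ρ A ⊎ Forces w ρ B
  Forces w ρ (A ⇒ B)  = ∀ v → w ≼ v → Forces v ρ A → Forces v ρ B
  Forces w ρ (∀' A)   = ∀ v → w ≼ v → (d : Dom) → Forces v (extend d ρ) A
  Forces w ρ (∃' A)   = Σ Dom λ d → Forces w (extend d ρ) A

  Forces-mono : ∀ {n} (A : Formula n) {ρ w v} → w ≼ v → Forces w ρ A → Forces v ρ A
  Forces-mono (atom p k ts) le x       = Atom-mono le p k _ x
  Forces-mono ⊥'            le ()
  Forces-mono ⊤'            le x       = x
  Forces-mono (A ∧' B)      le (x , y) = Forces-mono A le x , Forces-mono B le y
  Forces-mono (A ∨' B)      le (inj₁ x) = inj₁ (Forces-mono A le x)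
  Forces-mono (A ∨' B)      le (inj₂ y) = inj₂ (Forces-mono B le y)
  Forces-mono (A ⇒ B)       le f u le′ = f u (≼-trans le le′)
  Forces-mono (∀' A)        le f u le′ = f u (≼-trans le le′)
  Forces-mono (∃' A)        le (d , x) = d , Forces-mono A le x

  extend-lift : ∀ {n m} {σ : Fin n → Fin m} {ρ : Fin m → Dom} {ρ′ : Fin n → Dom}
              → (∀ i → ρ (σ i) ≡ ρ′ i) → ∀ d i → extend d ρ (lift σ i) ≡ extend d ρ′ i
  extend-lift h d zero    = refl
  extend-lift h d (suc i) = h i

  Forces-rename : ∀ {n m} (A : Formula n) {σ : Fin n → Fin m} {ρ : Fin m → Dom} {ρ′ : Fin n → Dom}
                → (∀ i → ρ (σ i) ≡ ρ′ i) → ∀ w → Forces w ρ (rename σ A) ⇔ Forces w ρ′ A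
  Forces-rename (atom p k ts) {σ} {ρ} {ρ′} h w =
    mk⇔ (subst (Atom w p k) ρσ≡ρ′) (subst (Atom w p k) (sym ρσ≡ρ′))
    where ρσ≡ρ′ : Vec.map ρ (Vec.map σ ts) ≡ Vec.map ρ′ ts
          ρσ≡ρ′ = trans (sym (Vec.map-∘ ρ σ ts)) (Vec.map-cong h ts)
  Forces-rename ⊥' h w = mk⇔ (λ x → x) (λ x → x)
  Forces-rename ⊤' h w = mk⇔ (λ x → x) (λ x → x)
  Forces-rename (A ∧' B) h w =
    mk⇔ (λ (x , y) → to (Forces-rename A h w) x , to (Forces-rename B h w) y)
        (λ (x , y) → from (Forces-rename A h w) x , from (Forces-rename B h w) y)
  Forces-rename (A ∨' B) h w =
    mk⇔ (λ { (inj₁ x) → inj₁ (to (Forces-rename A h w) x) ; (inj₂ y) → inj₂ (to (Forces-rename B h w) y) })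
        (λ { (inj₁ x) → inj₁ (from (Forces-rename A h w) x) ; (inj₂ y) → inj₂ (from (Forces-rename B h w) y) })
  Forces-rename (A ⇒ B) h w =
    mk⇔ (λ f v le x → to (Forces-rename B h v) (f v le (from (Forces-rename A h v) x)))
        (λ f v le x → from (Forces-rename B h v) (f v le (to (Forces-rename A h v) x)))
  Forces-rename (∀' A) h w =
    mk⇔ (λ f v le d → to (Forces-rename A (extend-lift h d) v) (f v le d))
        (λ f v le d → from (Forces-rename A (extend-lift h d) v) (f v le d))
  Forces-rename (∃' A) h w =
    mk⇔ (λ (d , x) → d , to (Forces-rename A (extend-lift h d) w) x)
        (λ (d , x) → d , from (Forces-rename A (extend-lift h d) w) x)

  Forces-shift : ∀ {n} (A : Formula n) {ρ : Fin n → Dom} d w → Forces w ρ A → Forces w (extend d ρ) (shift A)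
  Forces-shift A d w = from (Forces-rename A (λ _ → refl) w)

  Forces-inst : ∀ {n} (A : Formula (suc n)) {ρ : Fin n → Dom} t w
              → Forces w ρ (A [ t ]) ⇔ Forces w (extend (ρ t) ρ) A
  Forces-inst A {ρ} t = Forces-rename A inst-ρ
    where inst-ρ : ∀ i → ρ (inst t i) ≡ extend (ρ t) ρ i
          inst-ρ zero    = refl
          inst-ρ (suc i) = refl

  All-mono : ∀ {n} {Γ : List (Formula n)} {ρ w v} → w ≼ v → All (Forces w ρ) Γ → All (Forces v ρ) Γ
  All-mono le []                 = []
  All-mono le (_∷_ {x = A} x xs) = Forces-mono A le x ∷ All-mono le xs

  All-shift : ∀ {n} {Γ : List (Formula n)} {ρ w} d → All (Forces w ρ) Γ → All (Forces w (extend d ρ)) (List.map shift Γ)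
  All-shift d []                         = []
  All-shift {w = w} d (_∷_ {x = A} x xs) = Forces-shift A d w x ∷ All-shift d xs

  sound : ∀ {n} {Γ : List (Formula n)} {A} → Γ ⊢ A → ∀ w ρ → All (Forces w ρ) Γ → Forces w ρ A
  sound (hyp x)    w ρ γ = All.lookup γ x
  sound ⊤I         w ρ γ = tt
  sound (⊥E p)     w ρ γ = ⊥-elim (sound p w ρ γ)
  sound (∧I p q)   w ρ γ = sound p w ρ γ , sound q w ρ γ
  sound (∧E₁ p)    w ρ γ = proj₁ (sound p w ρ γ)
  sound (∧E₂ p)    w ρ γ = proj₂ (sound p w ρ γ)
  sound (∨I₁ p)    w ρ γ = inj₁ (sound p w ρ γ)
  sound (∨I₂ p)    w ρ γ = inj₂ (sound p w ρ γ)
  sound (∨E p q r) w ρ γ with sound p w ρ γ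
  ... | inj₁ x = sound q w ρ (x ∷ γ)
  ... | inj₂ y = sound r w ρ (y ∷ γ)
  sound (⇒I p)     w ρ γ v le x = sound p v ρ (x ∷ All-mono le γ)
  sound (⇒E p q)   w ρ γ = sound p w ρ γ w ≼-refl (sound q w ρ γ)
  sound (∀I p)     w ρ γ v le d = sound p v (extend d ρ) (All-shift d (All-mono le γ))
  sound (∀E {A = A} p t) w ρ γ = from (Forces-inst A t w) (sound p w ρ γ w ≼-refl (ρ t))
  sound (∃I {A = A} t p) w ρ γ = ρ t , to (Forces-inst A t w) (sound p w ρ γ)
  sound (∃E {C = C} p q) w ρ γ with sound p w ρ γ
  ... | d , x = to (Forces-rename C (λ _ → refl) w) (sound q w (extend d ρ) (x ∷ All-shift d γ))

  ρ∅ : Fin 0 → Dom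
  ρ∅ ()

  provable⇒forced : {X : Formula 0} → ILProves X → ∀ w → Forces w ρ∅ X
  provable⇒forced {X} p w = to (Forces-rename X (λ ()) w) (sound p w (λ _ → element) [])

-- Generic instances of the schematic letters: two propositional atoms and a unary atom.
atomA atomB : Formula 0
atomA = atom 0 0 []
atomB = atom 1 0 []

atomAx : Formula 1
atomAx = atom 0 1 (zero ∷ [])

equivalenceBin : Kind → NegN → Bin → BinRHS → Formula 0
equivalenceBin k N □ d = (lhsBin k N □ atomA atomB ⇒ rhsBin k N d atomA atomB)
                      ∧' (rhsBin k N d atomA atomB ⇒ lhsBin k N □ atomA atomB)

equivalenceQuant : Kind → NegN → Quant → QuantRHS → Formula 0
equivalenceQuant k N Q d = (lhsQuant k N Q atomAx ⇒ rhsQuant k N d atomAx)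
                        ∧' (rhsQuant k N d atomAx ⇒ lhsQuant k N Q atomAx)

-- Two-valued refutations.  A one-world Kripke model is a classical structure; with domain
-- Bool its forcing relation is decidable, so classical invalidity becomes a computation.
Valuation : Set
Valuation = ℕ → (k : ℕ) → Vec Bool k → Bool

twoValued : Valuation → KripkeModel
twoValued V = record
  { World = ⊤ ; _≼_ = λ _ _ → ⊤ ; ≼-refl = tt ; ≼-trans = λ _ _ → tt
  ; Dom = Bool ; element = true
  ; Atom = λ _ p k ts → T (V p k ts) ; Atom-mono = λ _ _ _ _ x → x }

module TwoValued (V : Valuation) where
  open Forcing (twoValued V)

  decide : ∀ {n} (A : Formula n) ρ → Dec (Forces tt ρ A)
  decide (atom p k ts) ρ = T? _
  decide ⊥'            ρ = no λ ()
  decide ⊤'            ρ = yes tt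
  decide (A ∧' B)      ρ = decide A ρ ×-dec decide B ρ
  decide (A ∨' B)      ρ = decide A ρ ⊎-dec decide B ρ
  decide (A ⇒ B)       ρ = map′ (λ f _ _ → f) (λ f → f tt tt) (decide A ρ →-dec decide B ρ)
  decide (∀' A)        ρ =
    map′ (λ (t , f) _ _ → λ { true → t ; false → f }) (λ g → g tt tt true , g tt tt false)
         (decide A (extend true ρ) ×-dec decide A (extend false ρ))
  decide (∃' A)        ρ =
    map′ (λ { (inj₁ t) → true , t ; (inj₂ f) → false , f }) (λ { (true , t) → inj₁ t ; (false , f) → inj₂ f })
         (decide A (extend true ρ) ⊎-dec decide A (extend false ρ))

  holds : Formula 0 → Bool
  holds X = isYes (decide X ρ∅)

  provable⇒holds : {X : Formula 0} → ILProves X → T (holds X)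
  provable⇒holds {X} p = fromWitness {a? = decide X ρ∅} (provable⇒forced p tt)

valuation : Bool → Bool → Bool → Bool → Valuation
valuation a b f t 0 0 []       = a
valuation a b f t 1 0 []       = b
valuation a b f t 0 1 (x ∷ []) = if x then t else f
valuation a b f t _ _ _        = false

every : (Bool → Bool) → Bool
every g = g true ∧ g false

every-intro : {g : Bool → Bool} → (∀ x → T (g x)) → T (every g)
every-intro h = from T-∧ (h true , h false)

classicallyValid : Formula 0 → Bool
classicallyValid X = every λ a → every λ b → every λ f → every λ t → TwoValued.holds (valuation a b f t) X

provable⇒classicallyValid : {X : Formula 0} → ILProves X → T (classicallyValid X)
provable⇒classicallyValid p =
  every-intro λ a → every-intro λ b → every-intro λ f → every-intro λ t → TwoValued.provable⇒holds (valuation a b f t) p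

classically-unprovable : {X : Formula 0} → T (not (classicallyValid X)) → ¬ ILProves X
classically-unprovable {X} fails p = not-T (classicallyValid X) (provable⇒classicallyValid p) fails
  where not-T : ∀ x → T x → ¬ T (not x)
        not-T true _ ()

module _ (M : KripkeModel) where
  open KripkeModel M
  open Forcing M

  refuted-at : ∀ {X Y : Formula 0} w → Forces w ρ∅ X → ¬ Forces w ρ∅ Y → ¬ ILProves (X ⇒ Y)
  refuted-at w x ¬y p = ¬y (provable⇒forced p w w ≼-refl x)

-- The fork: a root below two incomparable leaves.  atomA and A(true) hold exactly at the
-- left leaf, atomB and A(false) exactly at the right leaf.  It separates ¬¬ from ∨ and ∃.
data Fork : Set where
  root left right : Fork

data _⊑_ : Fork → Fork → Set where
  root⊑  : ∀ {w} → root ⊑ w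
  left⊑  : left ⊑ left
  right⊑ : right ⊑ right

⊑-refl : ∀ {w} → w ⊑ w
⊑-refl {root}  = root⊑
⊑-refl {left}  = left⊑
⊑-refl {right} = right⊑

⊑-trans : ∀ {u v w} → u ⊑ v → v ⊑ w → u ⊑ w
⊑-trans root⊑  _      = root⊑
⊑-trans left⊑  left⊑  = left⊑
⊑-trans right⊑ right⊑ = right⊑

LeftAtom RightAtom : ℕ → (k : ℕ) → Vec Bool k → Set
LeftAtom 0 0 []            = ⊤
LeftAtom 0 1 (true ∷ [])   = ⊤
LeftAtom _ _ _             = ⊥
RightAtom 1 0 []           = ⊤
RightAtom 0 1 (false ∷ []) = ⊤
RightAtom _ _ _            = ⊥

ForkAtom : Fork → ℕ → (k : ℕ) → Vec Bool k → Set
ForkAtom root  _ _ _ = ⊥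
ForkAtom left        = LeftAtom
ForkAtom right       = RightAtom

ForkAtom-mono : ∀ {w v} → w ⊑ v → ∀ p k ts → ForkAtom w p k ts → ForkAtom v p k ts
ForkAtom-mono left⊑  _ _ _ x = x
ForkAtom-mono right⊑ _ _ _ x = x

fork : KripkeModel
fork = record
  { World = Fork ; _≼_ = _⊑_ ; ≼-refl = ⊑-refl ; ≼-trans = ⊑-trans
  ; Dom = Bool ; element = true ; Atom = ForkAtom ; Atom-mono = ForkAtom-mono }

module _ where
  open Forcing fork

  fork-refutes-∨∨ : ¬ ValidBin outside two or (or , 0 , 0)
  fork-refutes-∨∨ (equiv , _) = refuted-at fork root lhs rhs (proj₁ (equiv 0 atomA atomB))
    where
      lhs : Forces root ρ∅ (negs 2 (negs 2 atomA ∨' negs 2 atomB))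
      lhs root  _ g = g left root⊑ (inj₁ λ { left left⊑ k → k left left⊑ tt })
      lhs left  _ g = g left left⊑ (inj₁ λ { left left⊑ k → k left left⊑ tt })
      lhs right _ g = g right right⊑ (inj₂ λ { right right⊑ k → k right right⊑ tt })
      rhs : ¬ Forces root ρ∅ (negs 2 atomA ∨' negs 2 atomB)
      rhs (inj₁ f) = f right root⊑ λ { right right⊑ () }
      rhs (inj₂ f) = f left root⊑ λ { left left⊑ () }

  fork-refutes-∧∨ : ¬ ValidBin outside one and (or , 0 , 0)
  fork-refutes-∧∨ (equiv , _) = refuted-at fork root lhs rhs (proj₁ (equiv 0 atomA atomB))
    where
      lhs : Forces root ρ∅ (negs 1 (negs 2 atomA ∧' negs 2 atomB))
      lhs root  _ (f , _) = f right root⊑ λ { right right⊑ () }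
      lhs left  _ (_ , f) = f left left⊑ λ { left left⊑ () }
      lhs right _ (f , _) = f right right⊑ λ { right right⊑ () }
      rhs : ¬ Forces root ρ∅ (negs 1 atomA ∨' negs 1 atomB)
      rhs (inj₁ f) = f left root⊑ tt
      rhs (inj₂ f) = f right root⊑ tt

  fork-refutes-∃∃ : ¬ ValidQuant outside two ex (ex , 0)
  fork-refutes-∃∃ (equiv , _) = refuted-at fork root lhs rhs (proj₁ (equiv 0 atomAx))
    where
      lhs : Forces root ρ∅ (negs 2 (∃' (negs 2 atomAx)))
      lhs root  _ g = g left root⊑ (true , λ { left left⊑ k → k left left⊑ tt })
      lhs left  _ g = g left left⊑ (true , λ { left left⊑ k → k left left⊑ tt })
      lhs right _ g = g right right⊑ (false , λ { right right⊑ k → k right right⊑ tt })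
      rhs : ¬ Forces root ρ∅ (∃' (negs 2 atomAx))
      rhs (true  , f) = f right root⊑ λ { right right⊑ () }
      rhs (false , f) = f left root⊑ λ { left left⊑ () }

  fork-refutes-∀∃ : ¬ ValidQuant outside one all (ex , 0)
  fork-refutes-∀∃ (equiv , _) = refuted-at fork root lhs rhs (proj₁ (equiv 0 atomAx))
    where
      lhs : Forces root ρ∅ (negs 1 (∀' (negs 2 atomAx)))
      lhs root  _ g = g left root⊑ false left left⊑ λ { left left⊑ () }
      lhs left  _ g = g left left⊑ false left left⊑ λ { left left⊑ () }
      lhs right _ g = g right right⊑ true right right⊑ λ { right right⊑ () }
      rhs : ¬ Forces root ρ∅ (∃' (negs 1 atomAx))
      rhs (true  , f) = f left root⊑ tt
      rhs (false , f) = f right root⊑ tt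

-- The growing model: worlds and domain are ℕ, and A(d) holds at world w iff d < w.
-- Every instance of A eventually holds, but ∀x A never does; it separates ¬¬ from ∀.
GrowingAtom : ℕ → ℕ → (k : ℕ) → Vec ℕ k → Set
GrowingAtom w 0 1 (d ∷ []) = d < w
GrowingAtom _ _ _ _        = ⊥

GrowingAtom-mono : ∀ {w v} → w ≤ v → ∀ p k ts → GrowingAtom w p k ts → GrowingAtom v p k ts
GrowingAtom-mono le 0 1 (d ∷ []) d<w = <-≤-trans d<w le

growing : KripkeModel
growing = record
  { World = ℕ ; _≼_ = _≤_ ; ≼-refl = ≤-refl ; ≼-trans = ≤-trans
  ; Dom = ℕ ; element = 0 ; Atom = GrowingAtom ; Atom-mono = GrowingAtom-mono }

eventually : ∀ d w → Σ ℕ λ v → w ≤ v × d < v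
eventually d w = suc (d + w) , ≤-trans (m≤n+m w d) (n≤1+n _) , s≤s (m≤m+n d w)

module _ where
  open Forcing growing

  -- ¬∀xA is forced everywhere, since A(w) fails at world w.
  never-all : Forces 0 ρ∅ (negs 1 (∀' atomAx))
  never-all v _ f = <-irrefl refl (f v ≤-refl v)

  growing-refutes-∀∀ : ¬ ValidQuant inside two all (all , 0)
  growing-refutes-∀∀ (equiv , _) = refuted-at growing 0 lhs rhs (proj₁ (equiv 0 atomAx))
    where
      lhs : Forces 0 ρ∅ (negs 2 (∀' (negs 2 atomAx)))
      lhs v _ g = g v ≤-refl λ u _ d u′ _ k → let (v′ , u′≤v′ , d<v′) = eventually d u′ in k v′ u′≤v′ d<v′
      rhs : ¬ Forces 0 ρ∅ (negs 2 (∀' atomAx))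
      rhs f = f 0 ≤-refl never-all

  growing-refutes-∃∀ : ¬ ValidQuant inside one ex (all , 0)
  growing-refutes-∃∀ (equiv , _) = refuted-at growing 0 never-all lhs (proj₂ (equiv 0 atomAx))
    where
      lhs : ¬ Forces 0 ρ∅ (negs 2 (∃' (negs 1 atomAx)))
      lhs f = f 0 ≤-refl λ v _ (d , ¬A) → let (v′ , v≤v′ , d<v′) = eventually d v in ¬A v′ v≤v′ d<v′

-- Renaming is functorial.  In particular a formula lifted under a binder and then
-- instantiated at the fresh variable is the formula itself, which is what ∀E and ∃I
-- produce inside ∀I and ∃E.
lift-∘ : ∀ {n m k} {σ : Fin m → Fin k} {τ : Fin n → Fin m} {υ : Fin n → Fin k}
       → (∀ i → σ (τ i) ≡ υ i) → ∀ i → lift σ (lift τ i) ≡ lift υ i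
lift-∘ h zero    = refl
lift-∘ h (suc i) = cong suc (h i)

rename-∘ : ∀ {n m k} (A : Formula n) {σ : Fin m → Fin k} {τ : Fin n → Fin m} {υ : Fin n → Fin k}
         → (∀ i → σ (τ i) ≡ υ i) → rename σ (rename τ A) ≡ rename υ A
rename-∘ (atom p k ts) {σ} {τ} h = cong (atom p k) (trans (sym (Vec.map-∘ σ τ ts)) (Vec.map-cong h ts))
rename-∘ ⊥'       h = refl
rename-∘ ⊤'       h = refl
rename-∘ (A ∧' B) h = cong₂ _∧'_ (rename-∘ A h) (rename-∘ B h)
rename-∘ (A ∨' B) h = cong₂ _∨'_ (rename-∘ A h) (rename-∘ B h)
rename-∘ (A ⇒ B)  h = cong₂ _⇒_ (rename-∘ A h) (rename-∘ B h)
rename-∘ (∀' A)   h = cong ∀' (rename-∘ A (lift-∘ h))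
rename-∘ (∃' A)   h = cong ∃' (rename-∘ A (lift-∘ h))

lift-id : ∀ {n} {σ : Fin n → Fin n} → (∀ i → σ i ≡ i) → ∀ i → lift σ i ≡ i
lift-id h zero    = refl
lift-id h (suc i) = cong suc (h i)

rename-id : ∀ {n} (A : Formula n) {σ : Fin n → Fin n} → (∀ i → σ i ≡ i) → rename σ A ≡ A
rename-id (atom p k ts) h = cong (atom p k) (trans (Vec.map-cong h ts) (Vec.map-id ts))
rename-id ⊥'       h = refl
rename-id ⊤'       h = refl
rename-id (A ∧' B) h = cong₂ _∧'_ (rename-id A h) (rename-id B h)
rename-id (A ∨' B) h = cong₂ _∨'_ (rename-id A h) (rename-id B h)
rename-id (A ⇒ B)  h = cong₂ _⇒_ (rename-id A h) (rename-id B h)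
rename-id (∀' A)   h = cong ∀' (rename-id A (lift-id h))
rename-id (∃' A)   h = cong ∃' (rename-id A (lift-id h))

instantiate-fresh : ∀ {n} (A : Formula (suc n)) → rename (lift suc) A [ zero ] ≡ A
instantiate-fresh A = trans (rename-∘ A inst-lift) (rename-id A λ _ → refl)
  where inst-lift : ∀ i → inst zero (lift suc i) ≡ i
        inst-lift zero    = refl
        inst-lift (suc i) = refl

to-instance : ∀ {n} {Γ : List (Formula (suc n))} (A : Formula (suc n)) → Γ ⊢ A → Γ ⊢ rename (lift suc) A [ zero ]
to-instance {Γ = Γ} A = subst (Γ ⊢_) (sym (instantiate-fresh A))

from-instance : ∀ {n} {Γ : List (Formula (suc n))} (A : Formula (suc n)) → Γ ⊢ rename (lift suc) A [ zero ] → Γ ⊢ A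
from-instance {Γ = Γ} A = subst (Γ ⊢_) (instantiate-fresh A)

module _ {n : ℕ} {Γ : List (Formula n)} where
  v0 : ∀ {A} → (A ∷ Γ) ⊢ A
  v0 = hyp (here refl)
  v1 : ∀ {A B} → (B ∷ A ∷ Γ) ⊢ A
  v1 = hyp (there (here refl))
  v2 : ∀ {A B C} → (C ∷ B ∷ A ∷ Γ) ⊢ A
  v2 = hyp (there (there (here refl)))
  v3 : ∀ {A B C D} → (D ∷ C ∷ B ∷ A ∷ Γ) ⊢ A
  v3 = hyp (there (there (there (here refl))))

lam : ∀ {n} {Γ : List (Formula n)} {A B} → (A ∷ Γ) ⊢ B → Γ ⊢ A ⇒ B
lam = ⇒I

infixl 5 _·_
_·_ : ∀ {n} {Γ : List (Formula n)} {A B} → Γ ⊢ A ⇒ B → Γ ⊢ A → Γ ⊢ B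
_·_ = ⇒E

infix 3 _⊣⊢_
_⊣⊢_ : ∀ {n} → Formula n → Formula n → Set
X ⊣⊢ Y = ([] ⊢ X ⇒ Y) × ([] ⊢ Y ⇒ X)

-- The sixteen equivalences of r₁ … r₄, for arbitrary formulas (left side ⊣⊢ right side).
-- They are used at shifted formulas, which is how ILEquiv is phrased.
module _ {m : ℕ} (A B : Formula m) where
  r₁-∧ : negs 2 (negs 2 A ∧' negs 2 B) ⊣⊢ negs 2 (A ∧' B)
  r₁-∧ = lam (lam (v1 · lam (∧E₁ v0 · lam (∧E₂ v1 · lam (v3 · ∧I v1 v0)))))
       , lam (lam (v1 · lam (v1 · ∧I (lam (v0 · ∧E₁ v1)) (lam (v0 · ∧E₂ v1)))))

  r₁-∨ : negs 2 (negs 2 A ∨' negs 2 B) ⊣⊢ negs 2 (A ∨' B)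
  r₁-∨ = lam (lam (v1 · lam (∨E v0 (v0 · lam (v3 · ∨I₁ v0)) (v0 · lam (v3 · ∨I₂ v0)))))
       , lam (lam (v1 · lam (∨E v0 (v2 · ∨I₁ (lam (v0 · v1))) (v2 · ∨I₂ (lam (v0 · v1))))))

  r₁-⇒ : negs 2 (negs 2 A ⇒ negs 2 B) ⊣⊢ negs 2 (A ⇒ B)
  r₁-⇒ = lam (lam (v1 · lam ((v0 · lam (v2 · lam (⊥E (v1 · v0)))) · lam (v2 · lam v1))))
       , lam (lam (v1 · lam (v1 · lam (lam (v1 · lam (v1 · (v3 · v0)))))))

  r₂-∧ : negs 2 (negs 1 A ∧' negs 1 B) ⊣⊢ negs 1 (A ∨' B)
  r₂-∧ = lam (lam (v1 · lam (∨E v1 (∧E₁ v1 · v0) (∧E₂ v1 · v0))))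
       , lam (lam (v0 · ∧I (lam (v2 · ∨I₁ v0)) (lam (v2 · ∨I₂ v0))))

  r₂-∨ : negs 2 (negs 1 A ∨' negs 1 B) ⊣⊢ negs 1 (A ∧' B)
  r₂-∨ = lam (lam (v1 · lam (∨E v0 (v0 · ∧E₁ v2) (v0 · ∧E₂ v2))))
       , lam (lam (v0 · ∨I₁ (lam (v1 · ∨I₂ (lam (v3 · ∧I v1 v0))))))

  r₂-⇒ : negs 2 (negs 1 A ⇒ negs 1 B) ⊣⊢ negs 1 (negs 1 A ∧' B)
  r₂-⇒ = lam (lam (v1 · lam ((v0 · ∧E₁ v1) · ∧E₂ v1)))
       , lam (lam (v0 · lam (lam (v3 · ∧I v1 v0))))

  r₃-∧ : negs 2 (negs 2 A ∧' negs 2 B) ⊣⊢ (negs 2 A ∧' negs 2 B)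
  r₃-∧ = lam (∧I (lam (v1 · lam (∧E₁ v0 · v1))) (lam (v1 · lam (∧E₂ v0 · v1))))
       , lam (lam (v0 · v1))

  r₃-∨ : negs 2 (negs 2 A ∨' negs 2 B) ⊣⊢ (negs 3 A ⇒ negs 2 B)
  r₃-∨ = lam (lam (lam (v2 · lam (∨E v0 (v3 · v0) (v0 · v2)))))
       , lam (lam (v0 · ∨I₂ (v1 · lam (v1 · ∨I₁ v0))))

  r₃-⇒ : negs 2 (negs 2 A ⇒ negs 2 B) ⊣⊢ (negs 2 A ⇒ negs 2 B)
  r₃-⇒ = lam (lam (lam (v2 · lam ((v0 · v2) · v1))))
       , lam (lam (v0 · v1))

  r₄-∧ : negs 1 (negs 2 A ∧' negs 2 B) ⊣⊢ (negs 2 A ⇒ negs 1 B)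
  r₄-∧ = lam (lam (lam (v2 · ∧I v1 (lam (v0 · v1)))))
       , lam (lam (∧E₂ v0 · (v1 · ∧E₁ v0)))

  r₄-∨ : negs 1 (negs 2 A ∨' negs 2 B) ⊣⊢ (negs 1 A ∧' negs 1 B)
  r₄-∨ = lam (∧I (lam (v1 · ∨I₁ (lam (v0 · v1)))) (lam (v1 · ∨I₂ (lam (v0 · v1)))))
       , lam (lam (∨E v0 (v0 · ∧E₁ v2) (v0 · ∧E₂ v2)))

  r₄-⇒ : negs 1 (negs 2 A ⇒ negs 2 B) ⊣⊢ (negs 2 A ∧' negs 1 B)
  r₄-⇒ = lam (∧I (lam (v1 · lam (⊥E (v0 · v1)))) (lam (v1 · lam (lam (v0 · v2)))))
       , lam (lam ((v0 · ∧E₁ v1) · ∧E₂ v1))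

module _ {m : ℕ} (A : Formula (suc m)) where
  r₁-∃ : negs 2 (∃' (negs 2 A)) ⊣⊢ negs 2 (∃' A)
  r₁-∃ = lam (lam (v1 · lam (∃E v0 (v0 · lam (v3 · ∃I zero (to-instance A v0))))))
       , lam (lam (v1 · lam (∃E v0 (v2 · ∃I zero (to-instance (negs 2 A) (lam (v0 · v1)))))))

  r₂-∀ : negs 2 (∀' (negs 1 A)) ⊣⊢ negs 1 (∃' A)
  r₂-∀ = lam (lam (v1 · lam (∃E v1 (from-instance (negs 1 A) (∀E v1 zero) · v0))))
       , lam (lam (v0 · ∀I (lam (v2 · ∃I zero (to-instance A v0)))))

  r₃-∀ : negs 2 (∀' (negs 2 A)) ⊣⊢ ∀' (negs 2 A)
  r₃-∀ = lam (∀I (lam (v1 · lam (from-instance (negs 2 A) (∀E v0 zero) · v1))))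
       , lam (lam (v0 · v1))

  r₄-∃ : negs 1 (∃' (negs 2 A)) ⊣⊢ ∀' (negs 1 A)
  r₄-∃ = lam (∀I (lam (v1 · ∃I zero (to-instance (negs 2 A) (lam (v0 · v1))))))
       , lam (lam (∃E v0 (v0 · from-instance (negs 1 A) (∀E v2 zero))))

-- Right sides are compared by their negations beyond the fixed N, i.e. by |N₁| + |N₂|.
extraB : BinRHS → ℕ
extraB (_ , n₁ , n₂) = n₁ + n₂

extraQ : QuantRHS → ℕ
extraQ (_ , n₁) = n₁

extraB-reflects : ∀ k N d d* → rhsNegsBin k N d ≤ rhsNegsBin k N d* → extraB d ≤ extraB d*
extraB-reflects inside  N (_ , a , b) (_ , a* , b*) le =
  +-cancelˡ-≤ ∣ N ∣ (a + b) (a* + b*) (subst₂ _≤_ (+-assoc ∣ N ∣ a b) (+-assoc ∣ N ∣ a* b*) le)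
extraB-reflects outside N (_ , a , b) (_ , a* , b*) le = +-cancelʳ-≤ (2 * ∣ N ∣) (a + b) (a* + b*) le

extraQ-reflects : ∀ k N d d* → rhsNegsQuant k N d ≤ rhsNegsQuant k N d* → extraQ d ≤ extraQ d*
extraQ-reflects inside  N (_ , a) (_ , a*) le = +-cancelˡ-≤ ∣ N ∣ a a* le
extraQ-reflects outside N (_ , a) (_ , a*) le = +-cancelʳ-≤ ∣ N ∣ a a* le

extraQ-budget : ∀ k N d → rhsNegsQuant k N d < lhsNegsQuant k N → extraQ d ≤ 1
extraQ-budget inside  one (_ , a) lt = s≤s⁻¹ (+-cancelˡ-< 1 a 2 lt)
extraQ-budget inside  two (_ , a) lt = s≤s⁻¹ (+-cancelˡ-< 2 a 2 lt)
extraQ-budget outside one (_ , a) lt = s≤s⁻¹ (+-cancelʳ-< 1 a 2 lt)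
extraQ-budget outside two (_ , a) lt = s≤s⁻¹ (+-cancelʳ-< 2 a 2 lt)

-- A best entry is established by
-- a valid d* beating every competitor with no more extra negations, or, when no entry is
-- to be present, by refuting every candidate within the budget of extraQ-budget.  A
-- competitor whose two sides differ classically is refuted by evaluation at the use site.
module CandidatesBin (k : Kind) (N : NegN) (□ : Bin) where
  classically : ∀ d {_ : T (not (classicallyValid (equivalenceBin k N □ d)))} → ¬ ValidBin k N □ d
  classically d {fails} (equiv , _) =
    classically-unprovable fails (∧I (proj₁ (equiv 0 atomA atomB)) (proj₂ (equiv 0 atomA atomB)))

  present : ∀ d* → ValidBin k N □ d*
          → (∀ d → ValidBin k N □ d → extraB d ≤ extraB d* → d ≡ d*) → BestBin k N □ (just d*)
  present d* valid* unique = valid* , λ d valid le → unique d valid (extraB-reflects k N d d* le)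

module CandidatesQuant (k : Kind) (N : NegN) (Q : Quant) where
  classically : ∀ d {_ : T (not (classicallyValid (equivalenceQuant k N Q d)))} → ¬ ValidQuant k N Q d
  classically d {fails} (equiv , _) =
    classically-unprovable fails (∧I (proj₁ (equiv 0 atomAx)) (proj₂ (equiv 0 atomAx)))

  present : ∀ d* → ValidQuant k N Q d*
          → (∀ d → ValidQuant k N Q d → extraQ d ≤ extraQ d* → d ≡ d*) → BestQuant k N Q (just d*)
  present d* valid* unique = valid* , λ d valid le → unique d valid (extraQ-reflects k N d d* le)

  absent : (∀ d → ValidQuant k N Q d → extraQ d ≤ 1 → ⊥) → BestQuant k N Q nothing
  absent refute d valid = refute d valid (extraQ-budget k N d (proj₂ valid))

<-by-computation : ∀ {m n} {_ : T (m <ᵇ n)} → m < n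
<-by-computation {m} {n} {m<n} = <ᵇ⇒< m n m<n

r₁-optimal : Optimal r₁
r₁-optimal = best , bestQ
  where
  best : ∀ □ → BestBin inside two □ (binT r₁ □)
  best and = present _ ((λ _ A B → r₁-∧ (shift A) (shift B)) , <-by-computation) unique
    where open CandidatesBin inside two and
          unique : ∀ d → ValidBin inside two and d → extraB d ≤ 0 → d ≡ (and , 0 , 0)
          unique (and , 0 , 0)   _ _ = refl
          unique d@(or , 0 , 0)  v _ = ⊥-elim (classically d v)
          unique d@(imp , 0 , 0) v _ = ⊥-elim (classically d v)
          unique (_ , suc _ , _) _ ()
          unique (_ , 0 , suc _) _ ()
  best or = present _ ((λ _ A B → r₁-∨ (shift A) (shift B)) , <-by-computation) unique
    where open CandidatesBin inside two or
          unique : ∀ d → ValidBin inside two or d → extraB d ≤ 0 → d ≡ (or , 0 , 0)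
          unique d@(and , 0 , 0) v _ = ⊥-elim (classically d v)
          unique (or , 0 , 0)    _ _ = refl
          unique d@(imp , 0 , 0) v _ = ⊥-elim (classically d v)
          unique (_ , suc _ , _) _ ()
          unique (_ , 0 , suc _) _ ()
  best imp = present _ ((λ _ A B → r₁-⇒ (shift A) (shift B)) , <-by-computation) unique
    where open CandidatesBin inside two imp
          unique : ∀ d → ValidBin inside two imp d → extraB d ≤ 0 → d ≡ (imp , 0 , 0)
          unique d@(and , 0 , 0) v _ = ⊥-elim (classically d v)
          unique d@(or , 0 , 0)  v _ = ⊥-elim (classically d v)
          unique (imp , 0 , 0)   _ _ = refl
          unique (_ , suc _ , _) _ ()
          unique (_ , 0 , suc _) _ ()
  bestQ : ∀ Q → BestQuant inside two Q (quanT r₁ Q)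
  bestQ all = absent refute
    where open CandidatesQuant inside two all
          refute : ∀ d → ValidQuant inside two all d → extraQ d ≤ 1 → ⊥
          refute (all , 0)         v _ = growing-refutes-∀∀ v
          refute d@(ex , 0)        v _ = classically d v
          refute d@(all , 1)       v _ = classically d v
          refute d@(ex , 1)        v _ = classically d v
          refute (_ , suc (suc _)) _ (s≤s ())
  bestQ ex = present _ ((λ _ A → r₁-∃ (rename (lift suc) A)) , <-by-computation) unique
    where open CandidatesQuant inside two ex
          unique : ∀ d → ValidQuant inside two ex d → extraQ d ≤ 0 → d ≡ (ex , 0)
          unique d@(all , 0) v _ = ⊥-elim (classically d v)
          unique (ex , 0)    _ _ = refl
          unique (_ , suc _) _ ()

r₂-optimal : Optimal r₂
r₂-optimal = best , bestQ
  where
  best : ∀ □ → BestBin inside one □ (binT r₂ □)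
  best and = present _ ((λ _ A B → r₂-∧ (shift A) (shift B)) , <-by-computation) unique
    where open CandidatesBin inside one and
          unique : ∀ d → ValidBin inside one and d → extraB d ≤ 0 → d ≡ (or , 0 , 0)
          unique d@(and , 0 , 0) v _ = ⊥-elim (classically d v)
          unique (or , 0 , 0)    _ _ = refl
          unique d@(imp , 0 , 0) v _ = ⊥-elim (classically d v)
          unique (_ , suc _ , _) _ ()
          unique (_ , 0 , suc _) _ ()
  best or = present _ ((λ _ A B → r₂-∨ (shift A) (shift B)) , <-by-computation) unique
    where open CandidatesBin inside one or
          unique : ∀ d → ValidBin inside one or d → extraB d ≤ 0 → d ≡ (and , 0 , 0)
          unique (and , 0 , 0)   _ _ = refl
          unique d@(or , 0 , 0)  v _ = ⊥-elim (classically d v)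
          unique d@(imp , 0 , 0) v _ = ⊥-elim (classically d v)
          unique (_ , suc _ , _) _ ()
          unique (_ , 0 , suc _) _ ()
  best imp = present _ ((λ _ A B → r₂-⇒ (shift A) (shift B)) , <-by-computation) unique
    where open CandidatesBin inside one imp
          unique : ∀ d → ValidBin inside one imp d → extraB d ≤ 1 → d ≡ (and , 1 , 0)
          unique d@(and , 0 , 0)       v _ = ⊥-elim (classically d v)
          unique d@(or , 0 , 0)        v _ = ⊥-elim (classically d v)
          unique d@(imp , 0 , 0)       v _ = ⊥-elim (classically d v)
          unique (and , 1 , 0)         _ _ = refl
          unique d@(or , 1 , 0)        v _ = ⊥-elim (classically d v)
          unique d@(imp , 1 , 0)       v _ = ⊥-elim (classically d v)
          unique d@(and , 0 , 1)       v _ = ⊥-elim (classically d v)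
          unique d@(or , 0 , 1)        v _ = ⊥-elim (classically d v)
          unique d@(imp , 0 , 1)       v _ = ⊥-elim (classically d v)
          unique (_ , suc (suc _) , _) _ (s≤s ())
          unique (_ , 1 , suc _)       _ (s≤s ())
          unique (_ , 0 , suc (suc _)) _ (s≤s ())
  bestQ : ∀ Q → BestQuant inside one Q (quanT r₂ Q)
  bestQ all = present _ ((λ _ A → r₂-∀ (rename (lift suc) A)) , <-by-computation) unique
    where open CandidatesQuant inside one all
          unique : ∀ d → ValidQuant inside one all d → extraQ d ≤ 0 → d ≡ (ex , 0)
          unique d@(all , 0) v _ = ⊥-elim (classically d v)
          unique (ex , 0)    _ _ = refl
          unique (_ , suc _) _ ()
  bestQ ex = absent refute
    where open CandidatesQuant inside one ex
          refute : ∀ d → ValidQuant inside one ex d → extraQ d ≤ 1 → ⊥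
          refute (all , 0)         v _ = growing-refutes-∃∀ v
          refute d@(ex , 0)        v _ = classically d v
          refute d@(all , 1)       v _ = classically d v
          refute d@(ex , 1)        v _ = classically d v
          refute (_ , suc (suc _)) _ (s≤s ())

r₃-optimal : Optimal r₃
r₃-optimal = best , bestQ
  where
  best : ∀ □ → BestBin outside two □ (binT r₃ □)
  best and = present _ ((λ _ A B → r₃-∧ (shift A) (shift B)) , <-by-computation) unique
    where open CandidatesBin outside two and
          unique : ∀ d → ValidBin outside two and d → extraB d ≤ 0 → d ≡ (and , 0 , 0)
          unique (and , 0 , 0)   _ _ = refl
          unique d@(or , 0 , 0)  v _ = ⊥-elim (classically d v)
          unique d@(imp , 0 , 0) v _ = ⊥-elim (classically d v)
          unique (_ , suc _ , _) _ ()
          unique (_ , 0 , suc _) _ ()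
  best or = present _ ((λ _ A B → r₃-∨ (shift A) (shift B)) , <-by-computation) unique
    where open CandidatesBin outside two or
          unique : ∀ d → ValidBin outside two or d → extraB d ≤ 1 → d ≡ (imp , 1 , 0)
          unique d@(and , 0 , 0)       v _ = ⊥-elim (classically d v)
          unique (or , 0 , 0)          v _ = ⊥-elim (fork-refutes-∨∨ v)
          unique d@(imp , 0 , 0)       v _ = ⊥-elim (classically d v)
          unique d@(and , 1 , 0)       v _ = ⊥-elim (classically d v)
          unique d@(or , 1 , 0)        v _ = ⊥-elim (classically d v)
          unique (imp , 1 , 0)         _ _ = refl
          unique d@(and , 0 , 1)       v _ = ⊥-elim (classically d v)
          unique d@(or , 0 , 1)        v _ = ⊥-elim (classically d v)
          unique d@(imp , 0 , 1)       v _ = ⊥-elim (classically d v)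
          unique (_ , suc (suc _) , _) _ (s≤s ())
          unique (_ , 1 , suc _)       _ (s≤s ())
          unique (_ , 0 , suc (suc _)) _ (s≤s ())
  best imp = present _ ((λ _ A B → r₃-⇒ (shift A) (shift B)) , <-by-computation) unique
    where open CandidatesBin outside two imp
          unique : ∀ d → ValidBin outside two imp d → extraB d ≤ 0 → d ≡ (imp , 0 , 0)
          unique d@(and , 0 , 0) v _ = ⊥-elim (classically d v)
          unique d@(or , 0 , 0)  v _ = ⊥-elim (classically d v)
          unique (imp , 0 , 0)   _ _ = refl
          unique (_ , suc _ , _) _ ()
          unique (_ , 0 , suc _) _ ()
  bestQ : ∀ Q → BestQuant outside two Q (quanT r₃ Q)
  bestQ all = present _ ((λ _ A → r₃-∀ (rename (lift suc) A)) , <-by-computation) unique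
    where open CandidatesQuant outside two all
          unique : ∀ d → ValidQuant outside two all d → extraQ d ≤ 0 → d ≡ (all , 0)
          unique (all , 0)   _ _ = refl
          unique d@(ex , 0)  v _ = ⊥-elim (classically d v)
          unique (_ , suc _) _ ()
  bestQ ex = absent refute
    where open CandidatesQuant outside two ex
          refute : ∀ d → ValidQuant outside two ex d → extraQ d ≤ 1 → ⊥
          refute d@(all , 0)       v _ = classically d v
          refute (ex , 0)          v _ = fork-refutes-∃∃ v
          refute d@(all , 1)       v _ = classically d v
          refute d@(ex , 1)        v _ = classically d v
          refute (_ , suc (suc _)) _ (s≤s ())

r₄-optimal : Optimal r₄
r₄-optimal = best , bestQ
  where
  best : ∀ □ → BestBin outside one □ (binT r₄ □)
  best and = present _ ((λ _ A B → r₄-∧ (shift A) (shift B)) , <-by-computation) unique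
    where open CandidatesBin outside one and
          unique : ∀ d → ValidBin outside one and d → extraB d ≤ 1 → d ≡ (imp , 1 , 0)
          unique d@(and , 0 , 0)       v _ = ⊥-elim (classically d v)
          unique (or , 0 , 0)          v _ = ⊥-elim (fork-refutes-∧∨ v)
          unique d@(imp , 0 , 0)       v _ = ⊥-elim (classically d v)
          unique d@(and , 1 , 0)       v _ = ⊥-elim (classically d v)
          unique d@(or , 1 , 0)        v _ = ⊥-elim (classically d v)
          unique (imp , 1 , 0)         _ _ = refl
          unique d@(and , 0 , 1)       v _ = ⊥-elim (classically d v)
          unique d@(or , 0 , 1)        v _ = ⊥-elim (classically d v)
          unique d@(imp , 0 , 1)       v _ = ⊥-elim (classically d v)
          unique (_ , suc (suc _) , _) _ (s≤s ())
          unique (_ , 1 , suc _)       _ (s≤s ())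
          unique (_ , 0 , suc (suc _)) _ (s≤s ())
  best or = present _ ((λ _ A B → r₄-∨ (shift A) (shift B)) , <-by-computation) unique
    where open CandidatesBin outside one or
          unique : ∀ d → ValidBin outside one or d → extraB d ≤ 0 → d ≡ (and , 0 , 0)
          unique (and , 0 , 0)   _ _ = refl
          unique d@(or , 0 , 0)  v _ = ⊥-elim (classically d v)
          unique d@(imp , 0 , 0) v _ = ⊥-elim (classically d v)
          unique (_ , suc _ , _) _ ()
          unique (_ , 0 , suc _) _ ()
  best imp = present _ ((λ _ A B → r₄-⇒ (shift A) (shift B)) , <-by-computation) unique
    where open CandidatesBin outside one imp
          unique : ∀ d → ValidBin outside one imp d → extraB d ≤ 1 → d ≡ (and , 1 , 0)
          unique d@(and , 0 , 0)       v _ = ⊥-elim (classically d v)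
          unique d@(or , 0 , 0)        v _ = ⊥-elim (classically d v)
          unique d@(imp , 0 , 0)       v _ = ⊥-elim (classically d v)
          unique (and , 1 , 0)         _ _ = refl
          unique d@(or , 1 , 0)        v _ = ⊥-elim (classically d v)
          unique d@(imp , 1 , 0)       v _ = ⊥-elim (classically d v)
          unique d@(and , 0 , 1)       v _ = ⊥-elim (classically d v)
          unique d@(or , 0 , 1)        v _ = ⊥-elim (classically d v)
          unique d@(imp , 0 , 1)       v _ = ⊥-elim (classically d v)
          unique (_ , suc (suc _) , _) _ (s≤s ())
          unique (_ , 1 , suc _)       _ (s≤s ())
          unique (_ , 0 , suc (suc _)) _ (s≤s ())
  bestQ : ∀ Q → BestQuant outside one Q (quanT r₄ Q)
  bestQ all = absent refute
    where open CandidatesQuant outside one all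
          refute : ∀ d → ValidQuant outside one all d → extraQ d ≤ 1 → ⊥
          refute d@(all , 0)       v _ = classically d v
          refute (ex , 0)          v _ = fork-refutes-∀∃ v
          refute d@(all , 1)       v _ = classically d v
          refute d@(ex , 1)        v _ = classically d v
          refute (_ , suc (suc _)) _ (s≤s ())
  bestQ ex = present _ ((λ _ A → r₄-∃ (rename (lift suc) A)) , <-by-computation) unique
    where open CandidatesQuant outside one ex
          unique : ∀ d → ValidQuant outside one ex d → extraQ d ≤ 0 → d ≡ (all , 0)
          unique (all , 0)   _ _ = refl
          unique d@(ex , 0)  v _ = ⊥-elim (classically d v)
          unique (_ , suc _) _ ()

rFor : Kind → NegN → TransSet
rFor inside  two = r₁
rFor inside  one = r₂
rFor outside two = r₃
rFor outside one = r₄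

maximal⇔≈rFor : ∀ S → IsMaximal S ⇔ S ≈T rFor (kind S) (neg S)
maximal⇔≈rFor (mkTS inside  two b q) = characterisation r₁-optimal (and , _ , refl) b q
maximal⇔≈rFor (mkTS inside  one b q) = characterisation r₂-optimal (and , _ , refl) b q
maximal⇔≈rFor (mkTS outside two b q) = characterisation r₃-optimal (and , _ , refl) b q
maximal⇔≈rFor (mkTS outside one b q) = characterisation r₄-optimal (and , _ , refl) b q

≈rFor⇔≈some : ∀ S → S ≈T rFor (kind S) (neg S) ⇔ (S ≈T r₁ ⊎ S ≈T r₂ ⊎ S ≈T r₃ ⊎ S ≈T r₄)
≈rFor⇔≈some (mkTS inside two b q) =
  mk⇔ inj₁ λ { (inj₁ e) → e ; (inj₂ (inj₁ (_ , () , _))) ; (inj₂ (inj₂ (inj₁ (() , _))))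
             ; (inj₂ (inj₂ (inj₂ (() , _)))) }
≈rFor⇔≈some (mkTS inside one b q) =
  mk⇔ (λ e → inj₂ (inj₁ e)) λ { (inj₁ (_ , () , _)) ; (inj₂ (inj₁ e)) → e ; (inj₂ (inj₂ (inj₁ (() , _))))
                              ; (inj₂ (inj₂ (inj₂ (() , _)))) }
≈rFor⇔≈some (mkTS outside two b q) =
  mk⇔ (λ e → inj₂ (inj₂ (inj₁ e))) λ { (inj₁ (() , _)) ; (inj₂ (inj₁ (() , _))) ; (inj₂ (inj₂ (inj₁ e))) → e
                                     ; (inj₂ (inj₂ (inj₂ (_ , () , _)))) }
≈rFor⇔≈some (mkTS outside one b q) =
  mk⇔ (λ e → inj₂ (inj₂ (inj₂ e))) λ { (inj₁ (() , _)) ; (inj₂ (inj₁ (() , _))) ; (inj₂ (inj₂ (inj₁ (_ , () , _))))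
                                     ; (inj₂ (inj₂ (inj₂ e))) → e }

proposition8 : (S : TransSet) → IsMaximal S ⇔ (S ≈T r₁ ⊎ S ≈T r₂ ⊎ S ≈T r₃ ⊎ S ≈T r₄)
proposition8 S = ⇔.trans (maximal⇔≈rFor S) (≈rFor⇔≈some S)
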